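{- Let $(G,k)$ be a YES-instance of Annotated EWCD. Then there exists a solution in which, for every block $D$ of $G$, either all vertices of $D$ have identical signatures or the vertices of $D$ have pairwise distinct signatures.
   Context: Annotated EWCD (AEWCD): input is a graph $G=(V,E)$ with non-negative edge weights $w_e$, a set $S\subseteq V$ with non-negative vertex weights $w_v$ ($v\in S$), and a positive integer $k$. Let $A$ be the symmetric matrix with $A_{uv}=w_{uv}$ for edges, $A_{uv}=0$ for non-adjacent $u\neq v$, $A_{vv}=w_v$ for $v\in S$ and $A_{vv}=\star$ (wildcard) otherwise; $a\stackrel{\star}{=}b$ means $a=b$, $a=\star$ or $b=\star$ (entrywise for matrices). A solution is $(B,W)$ with $B\in\{0,1\}^{|V|\times k}$ and $W$ a $k\times k$ diagonal matrix with non-negative entries such that $A\stackrel{\star}{=}BWB^T$ (column $j$ of $B$ is the indicator of the $j$-th clique, $W_{jj}$ its weight); it is a YES-instance if a solution exists. The signature of vertex $u$ is the row $B_u$. Distinct $u,v$ are $\star$-twins if they are adjacent and $A_u\stackrel{\star}{=}A_v$ (rows, entrywise); blocks are the equivalence classes of vertices under "equal or $\star$-twins".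
   Formalization: The edge weights $w_e$, the vertex weights $w_v$ and the diagonal clique weights of $W$ are rational. -}

module Defs where

open import Data.Nat using (ℕ; zero; suc)
open import Data.Fin using (Fin; zero; suc; _≟_)
open import Data.Bool using (Bool; true; false; if_then_else_)
open import Data.Maybe using (Maybe; just; nothing)
open import Data.Rational using (ℚ; 0ℚ; _+_; _*_; _≤_)
open import Data.Unit using (⊤)
open import Data.Product using (Σ; _×_)
open import Data.Sum using (_⊎_)
open import Relation.Nullary using (¬_; does)
open import Relation.Binary.PropositionalEquality using (_≡_; _≢_)
open import Relation.Binary.Construct.Closure.ReflexiveTransitive using (Star)

sumFin : (k : ℕ) → (Fin k → ℚ) → ℚ
sumFin zero    f = 0ℚ
sumFin (suc k) f = f zero + sumFin k (λ j → f (suc j))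

bit : Bool → ℚ
bit true  = Data.Rational.1ℚ
bit false = 0ℚ

-- An instance of Annotated EWCD on vertex set Fin n (without k).
-- Diagonal: 'just w' means v ∈ S with weight w; 'nothing' means v ∉ S.
record AInstance (n : ℕ) : Set where
  field
    adj      : Fin n → Fin n → Bool
    adj-irr  : ∀ u → adj u u ≡ false
    adj-sym  : ∀ u v → adj u v ≡ adj v u
    ew       : Fin n → Fin n → ℚ
    ew-sym   : ∀ u v → adj u v ≡ true → ew u v ≡ ew v u
    ew-nonneg : ∀ u v → adj u v ≡ true → 0ℚ ≤ ew u v
    vw       : Fin n → Maybe ℚ
    vw-nonneg : ∀ v x → vw v ≡ just x → 0ℚ ≤ x

open AInstance public

-- The annotated matrix A; 'nothing' is the wildcard ⋆.
Amat : ∀ {n} → AInstance n → Fin n → Fin n → Maybe ℚ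
Amat I u v =
  if does (u ≟ v) then vw I u
  else (if adj I u v then just (ew I u v) else just 0ℚ)

_⋆=_ : Maybe ℚ → Maybe ℚ → Set
nothing ⋆= b       = ⊤
just a  ⋆= nothing = ⊤
just a  ⋆= just b  = a ≡ b

BWBt : ∀ {n k} → (Fin n → Fin k → Bool) → (Fin k → ℚ) → Fin n → Fin n → ℚ
BWBt {k = k} B W u v = sumFin k (λ j → (bit (B u j) * W j) * bit (B v j))

-- (B , W) is a solution: W diagonal (given by its diagonal) non-negative, A ⋆= B W Bᵀ.
IsSolution : ∀ {n} → AInstance n → (k : ℕ) →
             (Fin n → Fin k → Bool) → (Fin k → ℚ) → Set
IsSolution {n} I k B W =
  (∀ j → 0ℚ ≤ W j) × (∀ u v → Amat I u v ⋆= just (BWBt B W u v))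

YesInstance : ∀ {n} → AInstance n → ℕ → Set
YesInstance I k = Σ (Fin _ → Fin k → Bool) λ B → Σ (Fin k → ℚ) λ W → IsSolution I k B W

StarTwin : ∀ {n} → AInstance n → Fin n → Fin n → Set
StarTwin I u v = u ≢ v × adj I u v ≡ true × (∀ x → Amat I u x ⋆= Amat I v x)

SameBlock : ∀ {n} → AInstance n → Fin n → Fin n → Set
SameBlock I = Star (StarTwin I)

SameSig : ∀ {n k} → (Fin n → Fin k → Bool) → Fin n → Fin n → Set
SameSig B u v = ∀ j → B u j ≡ B v j

BlockUniformOrDistinct : ∀ {n k} → AInstance n → (Fin n → Fin k → Bool) → Fin n → Set
BlockUniformOrDistinct I B u =
  (∀ v w → SameBlock I u v → SameBlock I u w → SameSig B v w)
  ⊎ (∀ v w → SameBlock I u v → SameBlock I u w → v ≢ w → ¬ SameSig B v w)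

-- Off-diagonal entries of A are never wildcards, so two vertices whose rows are
-- ⋆-equal are interchangeable as endpoints of any entry, and ⋆-equality of rows is
-- an equivalence relation whose classes contain the blocks. If some vertex u of a
-- class shares its signature with another vertex w of the class, then giving the
-- whole class the signature of u keeps the solution valid: every entry inside the
-- class is ⋆-equal to A_uw, which the solution realises as (BWBᵀ)_uw = (BWBᵀ)_uu.
-- Choosing u canonically (the first such vertex of the class) makes the class
-- uniform; a class with no such vertex already has pairwise distinct signatures.
module Submission where

open import Defs
open import Data.Nat using (ℕ; _<_; zero; suc)
open import Data.Fin using (Fin; zero; suc; _≟_)
open import Data.Fin.Properties using (all?; any?)
open import Data.Bool using (Bool; true; false)
open import Data.Bool.Properties using () renaming (_≟_ to _≟ᵇ_)
open import Data.List using (List; []; _∷_; allFin; find)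
open import Data.List.Membership.Propositional.Properties using (∈-allFin)
open import Data.List.Relation.Unary.All as All using (All; []; _∷_)
open import Data.Maybe using (Maybe; just; nothing; fromMaybe)
open import Data.Rational using (ℚ; _+_; _*_)
open import Data.Rational.Properties using () renaming (_≟_ to _≟ℚ_)
open import Data.Product using (Σ; ∃; _×_; _,_; proj₁; proj₂)
open import Data.Sum using (_⊎_; inj₁; inj₂)
open import Data.Unit using (tt)
open import Function using (_∘_)
open import Level using (Level)
open import Relation.Nullary using (¬_; Dec; yes; no; contradiction)
open import Relation.Nullary.Decidable using (¬?; _×-dec_; map′)
open import Relation.Unary using (Pred; Decidable)
open import Relation.Binary.PropositionalEquality
open import Relation.Binary.Construct.Closure.ReflexiveTransitive using (ε; _◅_)

⋆=-reflexive : ∀ {a b : Maybe ℚ} → a ≡ b → a ⋆= b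
⋆=-reflexive {nothing} refl = tt
⋆=-reflexive {just _}  refl = refl

⋆=-sym : ∀ {a b : Maybe ℚ} → a ⋆= b → b ⋆= a
⋆=-sym {nothing} {nothing} _ = tt
⋆=-sym {nothing} {just _}  _ = tt
⋆=-sym {just _}  {nothing} _ = tt
⋆=-sym {just _}  {just _}  p = sym p

⋆=-trans-just : ∀ {a b c : Maybe ℚ} {q} → b ≡ just q → a ⋆= b → b ⋆= c → a ⋆= c
⋆=-trans-just {nothing}                 refl _ _ = tt
⋆=-trans-just {just _} {c = nothing}    refl _ _ = tt
⋆=-trans-just {just _} {c = just _}     refl p q = trans p q

≡-⋆=-trans : ∀ {a b c : Maybe ℚ} → a ≡ b → b ⋆= c → a ⋆= c
≡-⋆=-trans refl p = p

⋆=-≡-trans : ∀ {a b c : Maybe ℚ} → a ⋆= b → b ≡ c → a ⋆= c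
⋆=-≡-trans p refl = p

sumFin-cong : ∀ k {f g : Fin k → ℚ} → (∀ j → f j ≡ g j) → sumFin k f ≡ sumFin k g
sumFin-cong zero    _   = refl
sumFin-cong (suc k) f≗g = cong₂ _+_ (f≗g zero) (sumFin-cong k (f≗g ∘ suc))

BWBt-congʳ : ∀ {n k} (B : Fin n → Fin k → Bool) (W : Fin k → ℚ) u {v w} →
             SameSig B v w → BWBt B W u v ≡ BWBt B W u w
BWBt-congʳ B W u v∼w = sumFin-cong _ λ j → cong (λ b → bit (B u j) * W j * bit b) (v∼w j)

module _ {a p : Level} {A : Set a} where

  find-just : {P : Pred A p} (P? : Decidable P) (xs : List A) {r : A} →
              find P? xs ≡ just r → P r
  find-just P? (x ∷ xs) e with P? x
  find-just P? (x ∷ xs) refl | yes px = px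
  ... | no _ = find-just P? xs e

  find-nothing : {P : Pred A p} (P? : Decidable P) (xs : List A) →
                 find P? xs ≡ nothing → All (¬_ ∘ P) xs
  find-nothing P? []       _ = []
  find-nothing P? (x ∷ xs) e with P? x
  find-nothing P? (x ∷ xs) () | yes _
  ... | no ¬px = ¬px ∷ find-nothing P? xs e

  find-cong : ∀ {q} {P : Pred A p} {Q : Pred A q} (P? : Decidable P) (Q? : Decidable Q) →
              (∀ {x} → P x → Q x) → (∀ {x} → Q x → P x) →
              (xs : List A) → find P? xs ≡ find Q? xs
  find-cong P? Q? P⇒Q Q⇒P []       = refl
  find-cong P? Q? P⇒Q Q⇒P (x ∷ xs) with P? x | Q? x
  ... | yes _  | yes _  = refl
  ... | yes px | no ¬qx = contradiction (P⇒Q px) ¬qx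
  ... | no ¬px | yes qx = contradiction (Q⇒P qx) ¬px
  ... | no _   | no _   = find-cong P? Q? P⇒Q Q⇒P xs

module Rows {n : ℕ} (I : AInstance n) where

  A : Fin n → Fin n → Maybe ℚ
  A = Amat I

  Amat-sym : ∀ u v → A u v ≡ A v u
  Amat-sym u v with u ≟ v | v ≟ u
  ... | yes refl | yes _    = refl
  ... | yes refl | no v≢v   = contradiction refl v≢v
  ... | no u≢u   | yes refl = contradiction refl u≢u
  ... | no _     | no _ with adj I u v in uv | adj I v u in vu
  ...   | true  | true  = cong just (ew-sym I u v uv)
  ...   | true  | false = contradiction (trans (sym uv) (trans (adj-sym I u v) vu)) λ ()
  ...   | false | true  = contradiction (trans (sym vu) (trans (adj-sym I v u) uv)) λ ()
  ...   | false | false = refl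

  ⋆=-trans-offDiag : ∀ {a b : Maybe ℚ} {u v} → u ≢ v → a ⋆= A u v → A u v ⋆= b → a ⋆= b
  ⋆=-trans-offDiag {u = u} {v} u≢v = ⋆=-trans-just (proj₂ concrete)
    where
    concrete : ∃ λ q → A u v ≡ just q
    concrete with u ≟ v
    ... | yes u≡v = contradiction u≡v u≢v
    ... | no _ with adj I u v
    ...   | true  = _ , refl
    ...   | false = _ , refl

  infix 4 _≈ʳ_
  record _≈ʳ_ (x y : Fin n) : Set where
    constructor mk≈ʳ
    field entry : ∀ z → A x z ⋆= A y z
  open _≈ʳ_

  _≈ʳ?_ : ∀ x y → Dec (x ≈ʳ y)
  x ≈ʳ? y = map′ mk≈ʳ entry (all? λ z → ⋆=? (A x z) (A y z))
    where
    ⋆=? : ∀ a b → Dec (a ⋆= b)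
    ⋆=? nothing  _        = yes tt
    ⋆=? (just _) nothing  = yes tt
    ⋆=? (just a) (just b) = a ≟ℚ b

  ≈ʳ-refl : ∀ {x} → x ≈ʳ x
  ≈ʳ-refl = mk≈ʳ λ _ → ⋆=-reflexive refl

  ≈ʳ-sym : ∀ {x y} → x ≈ʳ y → y ≈ʳ x
  ≈ʳ-sym x≈y = mk≈ʳ (⋆=-sym ∘ entry x≈y)

  Amat-resp-≈ʳ : ∀ {x y u v} → x ≈ʳ u → y ≈ʳ v → A x y ⋆= A u v
  Amat-resp-≈ʳ {x} {y} {u} {v} x≈u y≈v with u ≟ y | v ≟ x
  ... | no u≢y   | _        =
    ⋆=-trans-offDiag u≢y (entry x≈u y)
      (≡-⋆=-trans (Amat-sym u y) (⋆=-≡-trans (entry y≈v u) (Amat-sym v u)))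
  ... | yes refl | no v≢x   =
    ≡-⋆=-trans (Amat-sym x u)
      (⋆=-trans-offDiag v≢x (entry y≈v x) (≡-⋆=-trans (Amat-sym v x) (entry x≈u v)))
  ... | yes refl | yes refl = ⋆=-reflexive (Amat-sym v u)

  ≈ʳ-trans : ∀ {x y z} → x ≈ʳ y → y ≈ʳ z → x ≈ʳ z
  ≈ʳ-trans {x} {y} {z} x≈y y≈z = mk≈ʳ at
    where
    at : ∀ w → A x w ⋆= A z w
    at w with y ≟ w
    ... | no y≢w  = ⋆=-trans-offDiag y≢w (entry x≈y w) (entry y≈z w)
    ... | yes refl = ≡-⋆=-trans (Amat-sym x y) (Amat-resp-≈ʳ y≈z x≈y)

  SameBlock⇒≈ʳ : ∀ {u v} → SameBlock I u v → u ≈ʳ v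
  SameBlock⇒≈ʳ ε                    = ≈ʳ-refl
  SameBlock⇒≈ʳ ((_ , _ , u≈w) ◅ w∼v) = ≈ʳ-trans (mk≈ʳ u≈w) (SameBlock⇒≈ʳ w∼v)

module Normalisation {n k : ℕ} (I : AInstance n) (B : Fin n → Fin k → Bool) where
  open Rows I

  Duplicated : Fin n → Set
  Duplicated u = ∃ λ w → w ≢ u × u ≈ʳ w × SameSig B u w

  Duplicated? : ∀ u → Dec (Duplicated u)
  Duplicated? u = any? λ w → ¬? (w ≟ u) ×-dec (u ≈ʳ? w ×-dec all? λ j → B u j ≟ᵇ B w j)

  module _ (W : Fin k → ℚ) (sol : ∀ u v → A u v ⋆= just (BWBt B W u v)) where

    ⋆=-duplicate : ∀ {x y u} → x ≈ʳ u → y ≈ʳ u → Duplicated u → A x y ⋆= just (BWBt B W u u)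
    ⋆=-duplicate {u = u} x≈u y≈u (w , w≢u , u≈w , u∼w) =
      ⋆=-trans-offDiag (w≢u ∘ sym) (Amat-resp-≈ʳ x≈u (≈ʳ-trans y≈u u≈w))
        (⋆=-≡-trans (sol u w) (cong just (sym (BWBt-congʳ B W u u∼w))))

    ⋆=-representatives : ∀ {x y u v} → x ≈ʳ u → y ≈ʳ v →
      u ≡ x ⊎ Duplicated u → v ≡ y ⊎ Duplicated v → A x y ⋆= just (BWBt B W u v)
    ⋆=-representatives {u = u} {v} x≈u y≈v moved-u moved-v with u ≟ v
    ... | no u≢v = ⋆=-trans-offDiag u≢v (Amat-resp-≈ʳ x≈u y≈v) (sol u v)
    ... | yes refl with moved-u | moved-v
    ...   | inj₂ dup  | _         = ⋆=-duplicate x≈u y≈v dup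
    ...   | _         | inj₂ dup  = ⋆=-duplicate x≈u y≈v dup
    ...   | inj₁ refl | inj₁ refl = sol u u

  solution-retarget : ∀ {W} → IsSolution I k B W → (r : Fin n → Fin n) →
    (∀ x → x ≈ʳ r x) → (∀ x → r x ≡ x ⊎ Duplicated (r x)) → IsSolution I k (B ∘ r) W
  solution-retarget {W} (W≥0 , sol) r x≈rx moved = W≥0 , λ x y →
    ⋆=-representatives W sol (x≈rx x) (x≈rx y) (moved x) (moved y)

  IsPivot? : ∀ x u → Dec (x ≈ʳ u × Duplicated u)
  IsPivot? x u = x ≈ʳ? u ×-dec Duplicated? u

  pivot : Fin n → Maybe (Fin n)
  pivot x = find (IsPivot? x) (allFin n)

  representative : Fin n → Fin n
  representative x = fromMaybe x (pivot x)

  pivot-cong : ∀ {x y} → x ≈ʳ y → pivot x ≡ pivot y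
  pivot-cong x≈y = find-cong (IsPivot? _) (IsPivot? _)
    (λ (x≈u , dup) → ≈ʳ-trans (≈ʳ-sym x≈y) x≈u , dup)
    (λ (y≈u , dup) → ≈ʳ-trans x≈y y≈u , dup)
    (allFin n)

  representative-≈ʳ : ∀ x → x ≈ʳ representative x
  representative-≈ʳ x with pivot x in e
  ... | just u  = proj₁ (find-just (IsPivot? x) (allFin n) e)
  ... | nothing = ≈ʳ-refl

  representative-moved : ∀ x → representative x ≡ x ⊎ Duplicated (representative x)
  representative-moved x with pivot x in e
  ... | just u  = inj₂ (proj₂ (find-just (IsPivot? x) (allFin n) e))
  ... | nothing = inj₁ refl

  representative-class : ∀ {u v} m → u ≈ʳ v → pivot u ≡ m → representative v ≡ fromMaybe v m
  representative-class m u≈v e = cong (fromMaybe _) (trans (sym (pivot-cong u≈v)) e)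

  blockUniformOrDistinct : ∀ u → BlockUniformOrDistinct I (B ∘ representative) u
  blockUniformOrDistinct u with pivot u in e
  ... | just r  = inj₁ λ v w u∼v u∼w j →
    cong (λ z → B z j)
      (trans (representative-class _ (SameBlock⇒≈ʳ u∼v) e)
             (sym (representative-class _ (SameBlock⇒≈ʳ u∼w) e)))
  ... | nothing = inj₂ λ v w u∼v u∼w v≢w v∼w →
    let u≈v = SameBlock⇒≈ʳ u∼v
        u≈w = SameBlock⇒≈ʳ u∼w
        sameB : SameSig B v w
        sameB j = subst₂ (λ a b → B a j ≡ B b j)
          (representative-class _ u≈v e) (representative-class _ u≈w e) (v∼w j)
    in All.lookup (find-nothing (IsPivot? u) (allFin n) e) (∈-allFin v)
         (u≈v , w , v≢w ∘ sym , ≈ʳ-trans (≈ʳ-sym u≈v) u≈w , sameB)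

theorem5p3 : (n : ℕ) (I : AInstance n) (k : ℕ) → 0 < k → YesInstance I k →
    Σ (Fin n → Fin k → Bool) λ B → Σ (Fin k → ℚ) λ W →
      IsSolution I k B W × (∀ u → BlockUniformOrDistinct I B u)
theorem5p3 n I k _ (B , W , solution) =
  B ∘ representative , W ,
  solution-retarget solution representative representative-≈ʳ representative-moved ,
  blockUniformOrDistinct
  where open Normalisation I B
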